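{- For the knights graphs with $3$ rows: $\gamma_p(KN_{8k,3}) \le 10k$ for $k\ge 1$; $\gamma_p(KN_{8k+4,3}) \le 10k+6$ for $k\ge 0$; $\gamma_p(KN_{8k+5,3}) \le 10k+6$ for $k\ge 0$; $\gamma_p(KN_{8k+6,3}) \le 10k+7$ for $k\ge 0$; $\gamma_p(KN_{8k+7,3}) \le 10k+9$ for $k\ge 0$.
   Context: For a graph $G=(V,E)$, a set $S\subseteq V$ is a perfect dominating set if every vertex $v\in V\setminus S$ is adjacent to exactly one vertex of $S$. The perfect domination number $\gamma_p(G)$ is the minimum cardinality of a perfect dominating set of $G$. The knights graph $KN_{n,m}$ has vertex set $\{(i,j): 1\le i\le n,\ 1\le j\le m\}$ (column $i$, row $j$ of a chessboard with $n$ columns and $m$ rows), and $(a,b)$ is adjacent to $(c,d)$ iff $\{|a-c|,|b-d|\}=\{1,2\}$. -}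

module Defs where

open import Data.Nat using (ℕ; zero; suc; _+_; _*_; _≤_)
open import Data.Nat.Base using (∣_-_∣)
open import Data.Fin using (Fin; toℕ)
open import Data.Bool using (Bool; true; false; _∧_; _∨_; if_then_else_)
open import Data.Nat using (_≡ᵇ_)
open import Data.Product using (_×_; _,_; Σ; ∃)
open import Data.Vec.Functional using (foldr)
open import Relation.Binary.PropositionalEquality using (_≡_)

-- Vertices of KN_{n,m}: (i , j) with column i : Fin n, row j : Fin m
-- (0-indexed here; 1-indexed in the paper).
Vertex : ℕ → ℕ → Set
Vertex n m = Fin n × Fin m

knightAdj : ∀ {n m} → Vertex n m → Vertex n m → Bool
knightAdj (a , b) (c , d) =
  let x = ∣ toℕ a - toℕ c ∣ ; y = ∣ toℕ b - toℕ d ∣ in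
  ((x ≡ᵇ 1) ∧ (y ≡ᵇ 2)) ∨ ((x ≡ᵇ 2) ∧ (y ≡ᵇ 1))

VSet : ℕ → ℕ → Set
VSet n m = Vertex n m → Bool

sumFin : ∀ {k} → (Fin k → ℕ) → ℕ
sumFin f = foldr _+_ 0 f

sumV : ∀ {n m} → (Vertex n m → ℕ) → ℕ
sumV {n} {m} f = sumFin (λ i → sumFin (λ j → f (i , j)))

b2n : Bool → ℕ
b2n true = 1
b2n false = 0

card : ∀ {n m} → VSet n m → ℕ
card S = sumV (λ v → b2n (S v))

nbrsIn : ∀ {n m} → VSet n m → Vertex n m → ℕ
nbrsIn S v = sumV (λ w → b2n (S w ∧ knightAdj v w))

IsPerfectDominating : ∀ {n m} → VSet n m → Set
IsPerfectDominating {n} {m} S = ∀ (v : Vertex n m) → S v ≡ false → nbrsIn S v ≡ 1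

-- γ_p(KN_{n,m}) ≤ b  ⇔  some perfect dominating set has cardinality ≤ b
-- (γ_p is the minimum cardinality over the nonempty finite family of PDSs;
-- the full vertex set is always one).
γp≤ : ℕ → ℕ → ℕ → Set
γp≤ n m b = Σ (VSet n m) (λ S → IsPerfectDominating S × card S ≤ b)

-- A knight moves at most two columns, so on a board with three rows a set is
-- perfectly dominating as soon as every window of five consecutive columns
-- passes a check on its middle column.  The sets used are periodic: a short
-- lead, k copies of an 8-column block with 10 squares, and a short tail.
-- Inserting one more block does not change the outcome of the check, since
-- the windows of the inserted block see the same neighbouring columns as those
-- of the block after it; this holds by evaluation for an arbitrary
-- continuation of the board, so finitely many evaluations cover every k.
module Submission where

open import Defs
open import Data.Bool using (Bool; true; false; _∧_; _∨_; T)
open import Data.Bool.Properties using (∧-zeroʳ; T-∧)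
open import Data.Fin using (Fin; toℕ; zero; suc)
open import Data.Fin.Properties using (toℕ<n)
open import Data.List using (List; []; _∷_; _++_; length; map)
open import Data.List.Properties using (length-++; map-++)
open import Data.Nat using (ℕ; zero; suc; _+_; _*_; _≤_; _<_; z≤n; s≤s; _≡ᵇ_)
open import Data.Nat.Base using (∣_-_∣)
open import Data.Nat.ListAction using (sum)
open import Data.Nat.ListAction.Properties using (sum-++)
open import Data.Nat.Properties
  using (+-comm; +-assoc; +-identityʳ; *-zeroʳ; *-suc; ≤-reflexive; m≤m+n; ≡ᵇ⇒≡; ∣m+n-m+o∣≡∣n-o∣)
open import Data.Unit using (tt)
open import Data.Product using (_×_; _,_; proj₁; proj₂)
open import Function.Bundles using (Equivalence)
open import Relation.Binary.PropositionalEquality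
  using (_≡_; refl; sym; trans; cong; cong₂; subst; subst₂; module ≡-Reasoning)

open Equivalence using (to)

sumBelow : ℕ → (ℕ → ℕ) → ℕ
sumBelow zero    h = 0
sumBelow (suc n) h = h 0 + sumBelow n (λ c → h (suc c))

sumFin≡sumBelow : ∀ n (h : ℕ → ℕ) → sumFin {n} (λ i → h (toℕ i)) ≡ sumBelow n h
sumFin≡sumBelow zero    h = refl
sumFin≡sumBelow (suc n) h = cong (h 0 +_) (sumFin≡sumBelow n (λ c → h (suc c)))

sumBelow-cong : ∀ n {f g : ℕ → ℕ} → (∀ c → f c ≡ g c) → sumBelow n f ≡ sumBelow n g
sumBelow-cong zero    f≡g = refl
sumBelow-cong (suc n) f≡g = cong₂ _+_ (f≡g 0) (sumBelow-cong n (λ c → f≡g (suc c)))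

sumBelow-+ : ∀ m n (h : ℕ → ℕ) → sumBelow (m + n) h ≡ sumBelow m h + sumBelow n (λ c → h (m + c))
sumBelow-+ zero    n h = refl
sumBelow-+ (suc m) n h =
  trans (cong (h 0 +_) (sumBelow-+ m n (λ c → h (suc c)))) (sym (+-assoc (h 0) _ _))

sumBelow-zero : ∀ n (h : ℕ → ℕ) → (∀ c → c < n → h c ≡ 0) → sumBelow n h ≡ 0
sumBelow-zero zero    h h≡0 = refl
sumBelow-zero (suc n) h h≡0 rewrite h≡0 0 (s≤s z≤n) =
  sumBelow-zero n (λ c → h (suc c)) (λ c c<n → h≡0 (suc c) (s≤s c<n))

sumBelow-vanishing : ∀ m n (h : ℕ → ℕ) → (∀ c → m ≤ c → h c ≡ 0) → sumBelow (m + n) h ≡ sumBelow m h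
sumBelow-vanishing m n h h≡0 = begin
  sumBelow (m + n) h                                     ≡⟨ sumBelow-+ m n h ⟩
  sumBelow m h + sumBelow n (λ c → h (m + c))            ≡⟨ cong (sumBelow m h +_) tail≡0 ⟩
  sumBelow m h + 0                                       ≡⟨ +-identityʳ _ ⟩
  sumBelow m h                                           ∎
  where
  open ≡-Reasoning
  tail≡0 : sumBelow n (λ c → h (m + c)) ≡ 0
  tail≡0 = sumBelow-zero n _ (λ c _ → h≡0 (m + c) (m≤m+n m c))

sumBelow-window : ∀ n a w (h : ℕ → ℕ) →
  (∀ c → c < a → h c ≡ 0) → (∀ c → a + w ≤ c → h c ≡ 0) → (∀ c → n ≤ c → h c ≡ 0) →
  sumBelow n h ≡ sumBelow w (λ t → h (a + t))
sumBelow-window n a w h left right beyond = begin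
  sumBelow n h                                  ≡⟨ sym (sumBelow-vanishing n (a + w) h beyond) ⟩
  sumBelow (n + (a + w)) h                      ≡⟨ cong (λ m → sumBelow m h) (+-comm n (a + w)) ⟩
  sumBelow (a + w + n) h                        ≡⟨ sumBelow-vanishing (a + w) n h right ⟩
  sumBelow (a + w) h                            ≡⟨ sumBelow-+ a w h ⟩
  sumBelow a h + sumBelow w (λ t → h (a + t))   ≡⟨ cong (_+ sumBelow w (λ t → h (a + t))) (sumBelow-zero a h left) ⟩
  sumBelow w (λ t → h (a + t))                  ∎
  where open ≡-Reasoning

-- A subset of a board with three rows, given column by column; the columns
-- past the end of the list are empty.
Column : Set
Column = Bool × Bool × Bool

empty : Column
empty = false , false , false

occupied : Column → ℕ → Bool
occupied (x , _ , _) 0 = x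
occupied (_ , y , _) 1 = y
occupied (_ , _ , z) 2 = z
occupied _ (suc (suc (suc _))) = false

column : List Column → ℕ → Column
column []       _       = empty
column (x ∷ xs) zero    = x
column (x ∷ xs) (suc c) = column xs c

column-beyond : ∀ L c → length L ≤ c → column L c ≡ empty
column-beyond []       c       _         = refl
column-beyond (x ∷ xs) (suc c) (s≤s L≤c) = column-beyond xs c L≤c

board : (L : List Column) → VSet (length L) 3
board L (i , j) = occupied (column L (toℕ i)) (toℕ j)

size : Column → ℕ
size col = sumBelow 3 (λ r → b2n (occupied col r))

count : List Column → ℕ
count L = sum (map size L)

sumBelow-column : ∀ (f : Column → ℕ) L → sumBelow (length L) (λ c → f (column L c)) ≡ sum (map f L)
sumBelow-column f []       = refl
sumBelow-column f (x ∷ xs) = cong (f x +_) (sumBelow-column f xs)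

card-board : ∀ L → card (board L) ≡ count L
card-board L = trans (sumFin≡sumBelow (length L) (λ c → size (column L c))) (sumBelow-column size L)

knightStep : ℕ → ℕ → Bool
knightStep dx dy = ((dx ≡ᵇ 1) ∧ (dy ≡ᵇ 2)) ∨ ((dx ≡ᵇ 2) ∧ (dy ≡ᵇ 1))

attacks : Column → ℕ → ℕ → ℕ
attacks col dx b = sumBelow 3 (λ r → b2n (occupied col r ∧ knightStep dx ∣ b - r ∣))

attacks-far : ∀ col dx b → 3 ≤ dx → attacks col dx b ≡ 0
attacks-far col (suc (suc (suc dx))) b (s≤s (s≤s (s≤s _))) =
  sumBelow-zero 3 _ (λ r _ → cong b2n (∧-zeroʳ (occupied col r)))

nbrsIn-board : ∀ L (i : Fin (length L)) (j : Fin 3) →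
  nbrsIn (board L) (i , j) ≡ sumBelow (length L) (λ c → attacks (column L c) ∣ toℕ i - c ∣ (toℕ j))
nbrsIn-board L i j = sumFin≡sumBelow (length L) (λ c → attacks (column L c) ∣ toℕ i - c ∣ (toℕ j))

c<a⇒3≤∣2+a-c∣ : ∀ a c → c < a → 3 ≤ ∣ 2 + a - c ∣
c<a⇒3≤∣2+a-c∣ (suc a) zero    _         = s≤s (s≤s (s≤s z≤n))
c<a⇒3≤∣2+a-c∣ (suc a) (suc c) (s≤s c<a) = c<a⇒3≤∣2+a-c∣ a c c<a

a+5≤c⇒3≤∣2+a-c∣ : ∀ a c → a + 5 ≤ c → 3 ≤ ∣ 2 + a - c ∣
a+5≤c⇒3≤∣2+a-c∣ zero    (suc (suc (suc (suc (suc c))))) (s≤s (s≤s (s≤s (s≤s (s≤s _))))) = s≤s (s≤s (s≤s z≤n))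
a+5≤c⇒3≤∣2+a-c∣ (suc a) (suc c)                         (s≤s a+5≤c)                     = a+5≤c⇒3≤∣2+a-c∣ a c a+5≤c

-- The window of column a of L: columns a - 2, …, a + 2, padded with two empty
-- columns on the left so that no subtraction occurs.
window : List Column → ℕ → ℕ → Column
window L a t = column (empty ∷ empty ∷ L) (a + t)

nbrsIn-board≡window : ∀ L (i : Fin (length L)) (j : Fin 3) →
  nbrsIn (board L) (i , j) ≡ sumBelow 5 (λ t → attacks (window L (toℕ i) t) ∣ 2 - t ∣ (toℕ j))
nbrsIn-board≡window L i j = begin
  nbrsIn (board L) (i , j)                                  ≡⟨ nbrsIn-board L i j ⟩
  sumBelow (2 + length L) h                                 ≡⟨ sumBelow-window (2 + length L) a 5 h left right beyond ⟩
  sumBelow 5 (λ t → h (a + t))                              ≡⟨ sumBelow-cong 5 (λ t → cong (λ d → attacks (window L a t) d b) (shift t)) ⟩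
  sumBelow 5 (λ t → attacks (window L a t) ∣ 2 - t ∣ b)    ∎
  where
  open ≡-Reasoning
  a = toℕ i
  b = toℕ j
  h : ℕ → ℕ
  h c = attacks (column (empty ∷ empty ∷ L) c) ∣ 2 + a - c ∣ b
  left : ∀ c → c < a → h c ≡ 0
  left c c<a = attacks-far (column (empty ∷ empty ∷ L) c) _ b (c<a⇒3≤∣2+a-c∣ a c c<a)
  right : ∀ c → a + 5 ≤ c → h c ≡ 0
  right c a+5≤c = attacks-far (column (empty ∷ empty ∷ L) c) _ b (a+5≤c⇒3≤∣2+a-c∣ a c a+5≤c)
  beyond : ∀ c → 2 + length L ≤ c → h c ≡ 0
  beyond c n≤c = cong (λ col → attacks col ∣ 2 + a - c ∣ b) (column-beyond (empty ∷ empty ∷ L) c n≤c)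
  shift : ∀ t → ∣ 2 + a - a + t ∣ ≡ ∣ 2 - t ∣
  shift t = trans (cong (∣_- a + t ∣) (+-comm 2 a)) (∣m+n-m+o∣≡∣n-o∣ a 2 t)

dominatedIn : (ℕ → Column) → ℕ → Bool
dominatedIn w b = occupied (w 2) b ∨ (sumBelow 5 (λ t → attacks (w t) ∣ 2 - t ∣ b) ≡ᵇ 1)

windowPerfect : (ℕ → Column) → Bool
windowPerfect w = dominatedIn w 0 ∧ dominatedIn w 1 ∧ dominatedIn w 2

-- p and q are the two columns to the left of the list.
windowsPerfectFrom : Column → Column → List Column → Bool
windowsPerfectFrom p q []       = true
windowsPerfectFrom p q (x ∷ xs) = windowPerfect (column (p ∷ q ∷ x ∷ xs)) ∧ windowsPerfectFrom q x xs

windowsPerfect : List Column → Bool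
windowsPerfect = windowsPerfectFrom empty empty

windowsPerfectFrom⇒windowPerfect : ∀ p q L a → T (windowsPerfectFrom p q L) → a < length L →
  T (windowPerfect (λ t → column (p ∷ q ∷ L) (a + t)))
windowsPerfectFrom⇒windowPerfect p q (x ∷ xs) zero    ok _         = proj₁ (to T-∧ ok)
windowsPerfectFrom⇒windowPerfect p q (x ∷ xs) (suc a) ok (s≤s a<n) =
  windowsPerfectFrom⇒windowPerfect q x xs a (proj₂ (to T-∧ ok)) a<n

windowPerfect⇒dominatedIn : ∀ w (b : Fin 3) → T (windowPerfect w) → T (dominatedIn w (toℕ b))
windowPerfect⇒dominatedIn w b ok with to (T-∧ {dominatedIn w 0}) ok
... | ok₀ , ok₁₂ with to (T-∧ {dominatedIn w 1}) ok₁₂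
windowPerfect⇒dominatedIn w zero             _ | ok₀ , _ | _   , _   = ok₀
windowPerfect⇒dominatedIn w (suc zero)       _ | _   , _ | ok₁ , _   = ok₁
windowPerfect⇒dominatedIn w (suc (suc zero)) _ | _   , _ | _   , ok₂ = ok₂

dominatedIn-free : ∀ w b → T (dominatedIn w b) → occupied (w 2) b ≡ false →
  sumBelow 5 (λ t → attacks (w t) ∣ 2 - t ∣ b) ≡ 1
dominatedIn-free w b ok free rewrite free = ≡ᵇ⇒≡ _ 1 ok

board-perfect : ∀ L → T (windowsPerfect L) → IsPerfectDominating (board L)
board-perfect L ok (i , j) free = trans (nbrsIn-board≡window L i j)
  (dominatedIn-free (window L a) b
    (windowPerfect⇒dominatedIn (window L a) j
      (windowsPerfectFrom⇒windowPerfect empty empty L a ok (toℕ<n i)))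
    (subst (λ c → occupied (column (empty ∷ empty ∷ L) c) b ≡ false) (+-comm 2 a) free))
  where
  a = toℕ i
  b = toℕ j

γp≤-board : ∀ L → T (windowsPerfect L) → γp≤ (length L) 3 (count L)
γp≤-board L ok = board L , board-perfect L ok , ≤-reflexive (card-board L)

blocks : List Column → List Column → ℕ → List Column
blocks B E zero    = E
blocks B E (suc k) = B ++ blocks B E k

module _ (μ : List Column → ℕ) (μ-++ : ∀ xs ys → μ (xs ++ ys) ≡ μ xs + μ ys) where

  μ-blocks : ∀ B E k → μ (blocks B E k) ≡ μ B * k + μ E
  μ-blocks B E zero    = cong (_+ μ E) (sym (*-zeroʳ (μ B)))
  μ-blocks B E (suc k) = begin
    μ (B ++ blocks B E k)          ≡⟨ μ-++ B (blocks B E k) ⟩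
    μ B + μ (blocks B E k)         ≡⟨ cong (μ B +_) (μ-blocks B E k) ⟩
    μ B + (μ B * k + μ E)          ≡⟨ sym (+-assoc (μ B) _ _) ⟩
    μ B + μ B * k + μ E            ≡⟨ cong (_+ μ E) (sym (*-suc (μ B) k)) ⟩
    μ B * suc k + μ E              ∎
    where open ≡-Reasoning

  μ-periodic : ∀ H B E k → μ (H ++ blocks B E k) ≡ μ B * k + (μ H + μ E)
  μ-periodic H B E k = begin
    μ (H ++ blocks B E k)          ≡⟨ μ-++ H (blocks B E k) ⟩
    μ H + μ (blocks B E k)         ≡⟨ cong (μ H +_) (μ-blocks B E k) ⟩
    μ H + (μ B * k + μ E)          ≡⟨ sym (+-assoc (μ H) _ _) ⟩
    μ H + μ B * k + μ E            ≡⟨ cong (_+ μ E) (+-comm (μ H) (μ B * k)) ⟩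
    μ B * k + μ H + μ E            ≡⟨ +-assoc (μ B * k) _ _ ⟩
    μ B * k + (μ H + μ E)          ∎
    where open ≡-Reasoning

count-++ : ∀ xs ys → count (xs ++ ys) ≡ count xs + count ys
count-++ xs ys = trans (cong sum (map-++ size xs ys)) (sum-++ (map size xs) (map size ys))

windowsPerfect-periodic : ∀ H B E →
  T (windowsPerfect (H ++ E)) → T (windowsPerfect (H ++ B ++ E)) →
  (∀ Y → windowsPerfect (H ++ B ++ B ++ Y) ≡ windowsPerfect (H ++ B ++ Y)) →
  ∀ k → T (windowsPerfect (H ++ blocks B E k))
windowsPerfect-periodic H B E ok₀ ok₁ step zero          = ok₀
windowsPerfect-periodic H B E ok₀ ok₁ step (suc zero)    = ok₁
windowsPerfect-periodic H B E ok₀ ok₁ step (suc (suc k)) =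
  subst T (sym (step (blocks B E k))) (windowsPerfect-periodic H B E ok₀ ok₁ step (suc k))

γp≤-periodic : ∀ H B E →
  T (windowsPerfect (H ++ E)) → T (windowsPerfect (H ++ B ++ E)) →
  (∀ Y → windowsPerfect (H ++ B ++ B ++ Y) ≡ windowsPerfect (H ++ B ++ Y)) →
  ∀ k → γp≤ (length B * k + (length H + length E)) 3 (count B * k + (count H + count E))
γp≤-periodic H B E ok₀ ok₁ step k =
  subst₂ (λ n b → γp≤ n 3 b)
    (μ-periodic length (λ xs _ → length-++ xs) H B E k)
    (μ-periodic count count-++ H B E k)
    (γp≤-board (H ++ blocks B E k) (windowsPerfect-periodic H B E ok₀ ok₁ step k))

-- colₙ occupies row r exactly when bit r of n is set.
col₁ col₂ col₃ col₄ col₅ col₆ col₇ : Column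
col₁ = true  , false , false
col₂ = false , true  , false
col₃ = true  , true  , false
col₄ = false , false , true
col₅ = true  , false , true
col₆ = false , true  , true
col₇ = true  , true  , true

block₀ block₁ block₂ lead₄ lead₆ lead₇ : List Column
block₀ = empty ∷ col₅ ∷ col₁ ∷ col₆ ∷ col₁ ∷ col₇ ∷ empty ∷ col₂ ∷ []
block₁ = empty ∷ col₂ ∷ empty ∷ col₇ ∷ col₁ ∷ col₆ ∷ col₁ ∷ col₅ ∷ []
block₂ = empty ∷ col₂ ∷ empty ∷ col₅ ∷ col₁ ∷ col₆ ∷ col₁ ∷ col₇ ∷ []
lead₄  = col₁ ∷ col₃ ∷ col₄ ∷ col₅ ∷ []
lead₆  = col₁ ∷ col₄ ∷ col₆ ∷ col₁ ∷ col₅ ∷ []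
lead₇  = empty ∷ col₅ ∷ col₁ ∷ col₆ ∷ col₁ ∷ col₇ ∷ []

proposition2p3 :
    (∀ (k : ℕ) → 1 ≤ k → γp≤ (8 * k) 3 (10 * k))
    × (∀ (k : ℕ) → γp≤ (8 * k + 4) 3 (10 * k + 6))
    × (∀ (k : ℕ) → γp≤ (8 * k + 5) 3 (10 * k + 6))
    × (∀ (k : ℕ) → γp≤ (8 * k + 6) 3 (10 * k + 7))
    × (∀ (k : ℕ) → γp≤ (8 * k + 7) 3 (10 * k + 9))
proposition2p3 =
    (λ k _ → subst₂ (λ n b → γp≤ n 3 b) (+-identityʳ (8 * k)) (+-identityʳ (10 * k))
               (γp≤-periodic [] block₀ [] tt tt (λ _ → refl) k))
  , γp≤-periodic lead₄ block₁ [] tt tt (λ _ → refl)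
  , γp≤-periodic lead₄ block₁ (empty ∷ []) tt tt (λ _ → refl)
  , γp≤-periodic lead₆ block₁ (empty ∷ []) tt tt (λ _ → refl)
  , γp≤-periodic lead₇ block₂ (empty ∷ []) tt tt (λ _ → refl)
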